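{- Let \(H\) be a graph, \(k\geq 2\) an integer, and \(\mathcal{F}\) a family of subsets of \(V(H)\) such that every set in \(\mathcal{F}\) has at most \(k\) vertices, no set in \(\mathcal{F}\) is contained in another set of \(\mathcal{F}\), and \(H[A]\) is a clique for every \(A\in\mathcal{F}\). Then every vertex \(x\in V(H)\) is contained in at most \[\max\left(\binom{\Delta(H)}{k-1},\binom{2k-3}{k-1}\right)\] sets of \(\mathcal{F}\), where \(\Delta(H)\) is the maximum degree of \(H\). -}

module Defs where

open import Data.Nat using (ℕ; _⊔_)
open import Data.Bool using (Bool; true; false)
open import Data.Fin using (Fin)
open import Data.Fin.Subset using (Subset; ∣_∣; _∈_)
open import Data.Fin.Subset.Properties using (_∈?_)
open import Data.Vec using (tabulate)
open import Data.List using (List; length; filter; foldr; map; allFin)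
open import Relation.Binary.PropositionalEquality using (_≡_; _≢_)

record Graph (n : ℕ) : Set where
  field
    adj     : Fin n → Fin n → Bool
    sym     : ∀ u v → adj u v ≡ adj v u
    irrefl  : ∀ v → adj v v ≡ false
open Graph public

nbhd : ∀ {n} → Graph n → Fin n → Subset n
nbhd H v = tabulate (adj H v)

degree : ∀ {n} → Graph n → Fin n → ℕ
degree H v = ∣ nbhd H v ∣

maxDegree : ∀ {n} → Graph n → ℕ
maxDegree {n} H = foldr _⊔_ 0 (map (degree H) (allFin n))

IsClique : ∀ {n} → Graph n → Subset n → Set
IsClique H A = ∀ u v → u ∈ A → v ∈ A → u ≢ v → adj H u v ≡ true

countContaining : ∀ {m n} → (Fin m → Subset n) → Fin n → ℕ
countContaining {m} F x = length (filter (λ i → x ∈? F i) (allFin m))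

{-# OPTIONS --safe #-}
-- Removing x from the members of F that contain x leaves an antichain of subsets of the
-- neighbourhood N(x), each of size at most k - 1 because the members are cliques. By the
-- LYM inequality, an antichain in the subsets of a d-set whose members all have
-- C(d, |A|) ≤ T has at most T members. Since d ≤ Δ and binomial coefficients increase up to
-- the middle, C(d, a) ≤ C(Δ, k - 1) for a ≤ k - 1 when 2(k - 1) ≤ Δ, and otherwise
-- C(d, a) ≤ C(2k - 3, k - 1).
module Submission where

open import Defs hiding (sym)
open import Data.Bool using (true; false; if_then_else_)
open import Data.Empty using (⊥-elim)
open import Data.Fin using (Fin; zero; suc)
import Data.Fin as Fin
open import Data.Fin.Subset using (Subset; ∣_∣; _∈_; _∉_; _⊆_; _⊈_; _─_; _-_; ⁅_⁆; inside; outside)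
open import Data.Fin.Subset.Properties
  using ( _∈?_; drop-∷-⊆; ⊆-trans; p⊆q⇒∣p∣≤∣q∣; p⊂q⇒∣p∣<∣q∣; x∈⁅y⁆⇒x≡y; x∉⁅y⁆⇒x≢y; ∣⁅x⁆∣≡1
        ; x∈p∧x≢y⇒x∈p-y; p─q⊆p)
open import Data.List using (List; []; _∷_; length; filter; map; foldr; tabulate; allFin)
open import Data.List.Properties using (length-map; filter-none; map-cong; map-cong-local)
import Data.List.Membership.Propositional as List
open import Data.List.Membership.Propositional.Properties using (∈-map⁺; ∈-allFin)
import Data.List.Relation.Unary.All as All
open All using (All; []; _∷_)
open import Data.List.Relation.Unary.All.Properties using (all-filter; ¬Any⇒All¬)
import Data.List.Relation.Unary.All.Properties as AllP
open import Data.List.Relation.Unary.AllPairs using (AllPairs; []; _∷_)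
import Data.List.Relation.Unary.AllPairs.Properties as AllPairs
open import Data.List.Relation.Unary.Any using (Any; here; there; any?)
open import Data.List.Relation.Unary.Unique.Propositional.Properties using (allFin⁺)
open import Data.Nat hiding (∣_-_∣)
open import Data.Nat.Combinatorics
  using (_C_; nCk≡n!/k![n-k]!; k![n∸k]!∣n!; nCk+nC[k+1]≡[n+1]C[k+1]; [n-k]*d[k+1]≡[k+1]*d[k])
open import Data.Nat.DivMod using (m/n*n≡m)
open import Data.Nat.ListAction using (sum)
open import Data.Nat.Properties
open import Algebra.Properties.CommutativeSemigroup +-commutativeSemigroup using (interchange)
open import Data.Nat.Solver using (module +-*-Solver)
open import Data.Product using (_×_; _,_)
open import Data.Sum using (inj₁; inj₂)
open import Data.Vec using ([]; _∷_; lookup; here; there)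
open import Data.Vec.Properties using (lookup∘tabulate; lookup⇒[]=)
open import Function using (_∘_)
open import Relation.Nullary using (¬_; Dec; yes; no; does; contradiction)
open import Relation.Unary using (Decidable)
open import Relation.Binary.PropositionalEquality

open +-*-Solver

private variable
  A B : Set

nCk*k![n∸k]!≡n! : ∀ {n k} → k ≤ n → (n C k) * (k ! * (n ∸ k) !) ≡ n !
nCk*k![n∸k]!≡n! {n} {k} k≤n = begin
  (n C k) * (k ! * (n ∸ k) !)                 ≡⟨ cong (_* (k ! * (n ∸ k) !)) (nCk≡n!/k![n-k]! k≤n) ⟩
  n ! / (k ! * (n ∸ k) !) * (k ! * (n ∸ k) !) ≡⟨ m/n*n≡m (k![n∸k]!∣n! k≤n) ⟩
  n !                                         ∎
  where
  open ≡-Reasoning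
  instance _ = k !* (n ∸ k) !≢0

[k+1]*nC[k+1]≡[n∸k]*nCk : ∀ {n k} → k < n → suc k * (n C suc k) ≡ (n ∸ k) * (n C k)
[k+1]*nC[k+1]≡[n∸k]*nCk {n} {k} k<n = *-cancelʳ-≡ _ _ (k ! * (n ∸ k) !) {{k !* (n ∸ k) !≢0}} (begin
  suc k * X * d[k]               ≡⟨ solve 3 (λ s x d → s :* x :* d := x :* (s :* d)) refl (suc k) X d[k] ⟩
  X * (suc k * d[k])             ≡⟨ cong (X *_) ([n-k]*d[k+1]≡[k+1]*d[k] k<n) ⟨
  X * ((n ∸ k) * d[k+1])         ≡⟨ solve 3 (λ x m d → x :* (m :* d) := m :* (x :* d)) refl X (n ∸ k) d[k+1] ⟩
  (n ∸ k) * (X * d[k+1])         ≡⟨ cong ((n ∸ k) *_) (nCk*k![n∸k]!≡n! k<n) ⟩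
  (n ∸ k) * n !                  ≡⟨ cong ((n ∸ k) *_) (nCk*k![n∸k]!≡n! (<⇒≤ k<n)) ⟨
  (n ∸ k) * ((n C k) * d[k])     ≡⟨ *-assoc (n ∸ k) (n C k) d[k] ⟨
  (n ∸ k) * (n C k) * d[k]       ∎)
  where
  open ≡-Reasoning
  X = n C suc k
  d[k] = k ! * (n ∸ k) !
  d[k+1] = suc k ! * (n ∸ suc k) !

nCk≤nC[k+1] : ∀ {n k} → suc k + k ≤ n → n C k ≤ n C suc k
nCk≤nC[k+1] {n} {k} 1+k+k≤n = *-cancelˡ-≤ (suc k) (begin
  suc k * (n C k)        ≤⟨ *-monoˡ-≤ (n C k) (m+n≤o⇒m≤o∸n (suc k) 1+k+k≤n) ⟩
  (n ∸ k) * (n C k)      ≡⟨ [k+1]*nC[k+1]≡[n∸k]*nCk (m+n≤o⇒m≤o (suc k) 1+k+k≤n) ⟨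
  suc k * (n C suc k)    ∎)
  where open ≤-Reasoning

nCa≤nCb : ∀ {n a b} → a ≤ b → b + b ≤ suc n → n C a ≤ n C b
nCa≤nCb {b = zero} z≤n _ = ≤-refl
nCa≤nCb {n} {a} {suc b} a≤1+b 2b+2≤n+1 with m≤n⇒m<n∨m≡n a≤1+b
... | inj₂ refl = ≤-refl
... | inj₁ (s≤s a≤b) = ≤-trans (nCa≤nCb a≤b (≤-trans (+-mono-≤ (n≤1+n b) (n≤1+n b)) 2b+2≤n+1))
                               (nCk≤nC[k+1] (≤-pred (subst (_≤ suc n) (cong suc (+-suc b b)) 2b+2≤n+1)))

nCk≤[1+n]Ck : ∀ n k → n C k ≤ suc n C k
nCk≤[1+n]Ck n zero    = ≤-refl
nCk≤[1+n]Ck n (suc k) = subst (n C suc k ≤_) (nCk+nC[k+1]≡[n+1]C[k+1] n k) (m≤n+m (n C suc k) (n C k))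

m≤n⇒mCk≤nCk : ∀ {m n} k → m ≤ n → m C k ≤ n C k
m≤n⇒mCk≤nCk k m≤n with m≤n⇒m<n∨m≡n m≤n
... | inj₂ refl = ≤-refl
m≤n⇒mCk≤nCk {n = suc n} k m≤n | inj₁ (s≤s m≤n') = ≤-trans (m≤n⇒mCk≤nCk k m≤n') (nCk≤[1+n]Ck n k)

binomial≤max : ∀ {d Δ a r N} → d ≤ Δ → a ≤ r → r + r ≤ suc N → d C a ≤ (Δ C r) ⊔ (N C r)
binomial≤max {d} {Δ} {a} {r} {N} d≤Δ a≤r 2r≤1+N with r + r ≤? Δ
... | yes 2r≤Δ = begin
  d C a          ≤⟨ m≤n⇒mCk≤nCk a d≤Δ ⟩
  Δ C a          ≤⟨ nCa≤nCb a≤r (m≤n⇒m≤1+n 2r≤Δ) ⟩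
  Δ C r          ≤⟨ m≤m⊔n (Δ C r) (N C r) ⟩
  Δ C r ⊔ N C r  ∎
  where open ≤-Reasoning
... | no 2r≰Δ = begin
  d C a          ≤⟨ m≤n⇒mCk≤nCk a (≤-trans d≤Δ (≤-pred (≤-trans (≰⇒> 2r≰Δ) 2r≤1+N))) ⟩
  N C a          ≤⟨ nCa≤nCb a≤r 2r≤1+N ⟩
  N C r          ≤⟨ m≤n⊔m (Δ C r) (N C r) ⟩
  Δ C r ⊔ N C r  ∎
  where open ≤-Reasoning

sum-map-const : ∀ c (xs : List A) → sum (map (λ _ → c) xs) ≡ length xs * c
sum-map-const c []       = refl
sum-map-const c (x ∷ xs) = cong (c +_) (sum-map-const c xs)

sum-map-*ˡ : ∀ c (f : A → ℕ) xs → sum (map (λ x → c * f x) xs) ≡ c * sum (map f xs)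
sum-map-*ˡ c f []       = sym (*-zeroʳ c)
sum-map-*ˡ c f (x ∷ xs) = trans (cong (c * f x +_) (sum-map-*ˡ c f xs)) (sym (*-distribˡ-+ c (f x) _))

sum-map-+ : ∀ (f g : A → ℕ) xs → sum (map (λ x → f x + g x) xs) ≡ sum (map f xs) + sum (map g xs)
sum-map-+ f g []       = refl
sum-map-+ f g (x ∷ xs) = trans (cong (f x + g x +_) (sum-map-+ f g xs)) (interchange (f x) (g x) _ _)

sum-map-mono : ∀ {f g : A → ℕ} {xs} → All (λ x → f x ≤ g x) xs → sum (map f xs) ≤ sum (map g xs)
sum-map-mono []             = ≤-refl
sum-map-mono (fx≤gx ∷ fxs≤gxs) = +-mono-≤ fx≤gx (sum-map-mono fxs≤gxs)

sum-map-if : ∀ {P : A → Set} (P? : Decidable P) c xs →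
             sum (map (λ x → if does (P? x) then c else 0) xs) ≡ c * length (filter P? xs)
sum-map-if P? c []       = sym (*-zeroʳ c)
sum-map-if P? c (x ∷ xs) with does (P? x)
... | true  = trans (cong (c +_) (sum-map-if P? c xs)) (sym (*-suc c _))
... | false = sum-map-if P? c xs

sum-map-filter-comm : ∀ {R : A → B → Set} (R? : ∀ a b → Dec (R a b)) (f : B → ℕ) as bs →
  sum (map (λ a → sum (map f (filter (R? a) bs))) as) ≡ sum (map (λ b → f b * length (filter (λ a → R? a b) as)) bs)
sum-map-filter-comm R? f as []       = trans (sum-map-const 0 as) (*-zeroʳ (length as))
sum-map-filter-comm R? f as (b ∷ bs) = begin
  sum (map (λ a → sum (map f (filter (R? a) (b ∷ bs)))) as)
    ≡⟨ cong sum (map-cong split as) ⟩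
  sum (map (λ a → (if does (R? a b) then f b else 0) + sum (map f (filter (R? a) bs))) as)
    ≡⟨ sum-map-+ _ _ as ⟩
  sum (map (λ a → if does (R? a b) then f b else 0) as) + sum (map (λ a → sum (map f (filter (R? a) bs))) as)
    ≡⟨ cong₂ _+_ (sum-map-if (λ a → R? a b) (f b) as) (sum-map-filter-comm R? f as bs) ⟩
  f b * length (filter (λ a → R? a b) as) + sum (map (λ b → f b * length (filter (λ a → R? a b) as)) bs) ∎
  where
  open ≡-Reasoning
  split : ∀ a → sum (map f (filter (R? a) (b ∷ bs))) ≡ (if does (R? a b) then f b else 0) + sum (map f (filter (R? a) bs))
  split a with does (R? a b)
  ... | true  = refl
  ... | false = refl

∈?-does : ∀ {n} (x : Fin n) (p : Subset n) → does (x ∈? p) ≡ lookup p x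
∈?-does zero    (inside  ∷ p) = refl
∈?-does zero    (outside ∷ p) = refl
∈?-does (suc x) (_       ∷ p) = ∈?-does x p

length-filter-tabulate≡∣p∣ : ∀ {n} {P : A → Set} (P? : Decidable P) (f : Fin n → A) (p : Subset n) →
                         (∀ i → does (P? (f i)) ≡ lookup p i) → length (filter P? (tabulate f)) ≡ ∣ p ∣
length-filter-tabulate≡∣p∣ P? f []      _ = refl
length-filter-tabulate≡∣p∣ P? f (s ∷ p) P?f≡p with does (P? (f zero)) | P?f≡p zero
... | true  | refl = cong suc (length-filter-tabulate≡∣p∣ P? (f ∘ suc) p (P?f≡p ∘ suc))
... | false | refl = length-filter-tabulate≡∣p∣ P? (f ∘ suc) p (P?f≡p ∘ suc)

length-filter-∈?≡∣p∣ : ∀ {n} (p : Subset n) → length (filter (_∈? p) (allFin n)) ≡ ∣ p ∣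
length-filter-∈?≡∣p∣ p = length-filter-tabulate≡∣p∣ (_∈? p) (λ i → i) p (λ i → ∈?-does i p)

x∈p─q⇒x∉q : ∀ {n} {x : Fin n} (p q : Subset n) → x ∈ p ─ q → x ∉ q
x∈p─q⇒x∉q (_ ∷ p) (inside  ∷ q) () here
x∈p─q⇒x∉q (_ ∷ p) (outside ∷ q) here ()
x∈p─q⇒x∉q (_ ∷ p) (_       ∷ q) (there x∈p─q) (there x∈q) = x∈p─q⇒x∉q p q x∈p─q x∈q

∣p─q∣+∣q∣≡∣p∣ : ∀ {n} (p q : Subset n) → q ⊆ p → ∣ p ─ q ∣ + ∣ q ∣ ≡ ∣ p ∣
∣p─q∣+∣q∣≡∣p∣ []            []            _   = refl
∣p─q∣+∣q∣≡∣p∣ (inside  ∷ p) (inside  ∷ q) q⊆p =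
  trans (+-suc _ _) (cong suc (∣p─q∣+∣q∣≡∣p∣ p q (drop-∷-⊆ q⊆p)))
∣p─q∣+∣q∣≡∣p∣ (inside  ∷ p) (outside ∷ q) q⊆p = cong suc (∣p─q∣+∣q∣≡∣p∣ p q (drop-∷-⊆ q⊆p))
∣p─q∣+∣q∣≡∣p∣ (outside ∷ p) (inside  ∷ q) q⊆p with () ← q⊆p here
∣p─q∣+∣q∣≡∣p∣ (outside ∷ p) (outside ∷ q) q⊆p = ∣p─q∣+∣q∣≡∣p∣ p q (drop-∷-⊆ q⊆p)

∣p─q∣≡∣p∣∸∣q∣ : ∀ {n} (p q : Subset n) → q ⊆ p → ∣ p ─ q ∣ ≡ ∣ p ∣ ∸ ∣ q ∣
∣p─q∣≡∣p∣∸∣q∣ p q q⊆p =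
  trans (sym (m+n∸n≡m ∣ p ─ q ∣ ∣ q ∣)) (cong (_∸ ∣ q ∣) (∣p─q∣+∣q∣≡∣p∣ p q q⊆p))

∣p-x∣+1≡∣p∣ : ∀ {n} {x : Fin n} {p : Subset n} → x ∈ p → ∣ p - x ∣ + 1 ≡ ∣ p ∣
∣p-x∣+1≡∣p∣ {x = x} {p} x∈p = begin
  ∣ p - x ∣ + 1         ≡⟨ cong (∣ p - x ∣ +_) (∣⁅x⁆∣≡1 x) ⟨
  ∣ p - x ∣ + ∣ ⁅ x ⁆ ∣ ≡⟨ ∣p─q∣+∣q∣≡∣p∣ p ⁅ x ⁆ ⁅x⁆⊆p ⟩
  ∣ p ∣                 ∎
  where
  open ≡-Reasoning
  ⁅x⁆⊆p : ⁅ x ⁆ ⊆ p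
  ⁅x⁆⊆p y∈⁅x⁆ rewrite x∈⁅y⁆⇒x≡y _ y∈⁅x⁆ = x∈p

p⊆q∧∣q∣≤∣p∣⇒q⊆p : ∀ {n} {p q : Subset n} → p ⊆ q → ∣ q ∣ ≤ ∣ p ∣ → q ⊆ p
p⊆q∧∣q∣≤∣p∣⇒q⊆p {p = p} p⊆q ∣q∣≤∣p∣ {y} y∈q with y ∈? p
... | yes y∈p = y∈p
... | no  y∉p = contradiction ∣q∣≤∣p∣ (<⇒≱ (p⊂q⇒∣p∣<∣q∣ (p⊆q , y , y∈q , y∉p)))

p-x⊆q-x⇒p⊆q : ∀ {n} {x : Fin n} {p q : Subset n} → x ∈ q → p - x ⊆ q - x → p ⊆ q
p-x⊆q-x⇒p⊆q {x = x} {q = q} x∈q p-x⊆q-x {y} y∈p with y Fin.≟ x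
... | yes refl = x∈q
... | no  y≢x  = p─q⊆p q ⁅ x ⁆ (p-x⊆q-x (x∈p∧x≢y⇒x∈p-y y∈p y≢x))

p⊆q∧x∉p⇒p⊆q-x : ∀ {n} {x : Fin n} {p q : Subset n} → p ⊆ q → x ∉ p → p ⊆ q - x
p⊆q∧x∉p⇒p⊆q-x p⊆q x∉p y∈p = x∈p∧x≢y⇒x∈p-y (p⊆q y∈p) λ { refl → x∉p y∈p }

module _ {n : ℕ} where

  Incomparable : Subset n → Subset n → Set
  Incomparable p q = p ⊈ q × q ⊈ p

  -- lymWeight d A = d ! / C(d, ∣A∣), so LYM d is the LYM inequality Σ 1 / C(d, ∣A∣) ≤ 1 times d !.
  lymWeight : ℕ → Subset n → ℕ
  lymWeight d p = ∣ p ∣ ! * (d ∸ ∣ p ∣) !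

  LYM : ℕ → Set
  LYM d = ∀ {U : Subset n} {𝒜 : List (Subset n)} → ∣ U ∣ ≡ d → All (_⊆ U) 𝒜 → AllPairs Incomparable 𝒜 →
          sum (map (lymWeight d) 𝒜) ≤ d !

  lymWeight-full : ∀ {d} p → ∣ p ∣ ≡ d → lymWeight d p ≡ d !
  lymWeight-full p refl rewrite n∸n≡0 ∣ p ∣ = *-identityʳ (∣ p ∣ !)

  lymWeight-suc : ∀ {d} p → ∣ p ∣ ≤ d → lymWeight (suc d) p ≡ lymWeight d p * (suc d ∸ ∣ p ∣)
  lymWeight-suc {d} p ∣p∣≤d = begin
    a ! * (suc d ∸ a) !           ≡⟨ cong (λ m → a ! * m !) 1+d∸a≡1+[d∸a] ⟩
    a ! * (suc (d ∸ a) * (d ∸ a) !) ≡⟨ solve 3 (λ x s y → x :* (s :* y) := x :* y :* s) refl (a !) (suc (d ∸ a)) ((d ∸ a) !) ⟩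
    a ! * (d ∸ a) ! * suc (d ∸ a) ≡⟨ cong (a ! * (d ∸ a) ! *_) 1+d∸a≡1+[d∸a] ⟨
    a ! * (d ∸ a) ! * (suc d ∸ a) ∎
    where
    open ≡-Reasoning
    a = ∣ p ∣
    1+d∸a≡1+[d∸a] : suc d ∸ a ≡ suc (d ∸ a)
    1+d∸a≡1+[d∸a] = +-∸-assoc 1 ∣p∣≤d

  ⊆-full-member : ∀ {d} {U A B : Subset n} → ∣ U ∣ ≡ d → A ⊆ U → ∣ A ∣ ≡ d → B ⊆ U → B ⊆ A
  ⊆-full-member ∣U∣≡d A⊆U ∣A∣≡d B⊆U =
    ⊆-trans B⊆U (p⊆q∧∣q∣≤∣p∣⇒q⊆p A⊆U (≤-reflexive (trans ∣U∣≡d (sym ∣A∣≡d))))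

  -- A member of size ∣U∣ is U itself, which is comparable with every other member.
  lym-full : ∀ {d U 𝒜} → ∣ U ∣ ≡ d → Any (λ A → ∣ A ∣ ≡ d) 𝒜 → All (_⊆ U) 𝒜 → AllPairs Incomparable 𝒜 →
             sum (map (lymWeight d) 𝒜) ≤ d !
  lym-full {𝒜 = A ∷ []} _ (here ∣A∣≡d) _ _ = ≤-reflexive (trans (+-identityʳ _) (lymWeight-full A ∣A∣≡d))
  lym-full ∣U∣≡d (here ∣A∣≡d) (A⊆U ∷ B⊆U ∷ _) (((_ , B⊈A) ∷ _) ∷ _) =
    ⊥-elim (B⊈A (⊆-full-member ∣U∣≡d A⊆U ∣A∣≡d B⊆U))
  lym-full ∣U∣≡d (there full) (A⊆U ∷ ⊆U) (A-inc ∷ _)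
    with ((A⊈C , _) , C⊆U) , ∣C∣≡d ← All.lookupAny (All.zip (A-inc , ⊆U)) full =
    ⊥-elim (A⊈C (⊆-full-member ∣U∣≡d C⊆U ∣C∣≡d A⊆U))

  -- Double counting: lymWeight (suc d) A is lymWeight d A counted once for each i ∈ U ─ A, and
  -- the members avoiding a fixed i ∈ U form an antichain in U - i, to which the bound for d applies.
  lym-step : ∀ {d} → LYM d → ∀ {U 𝒜} → ∣ U ∣ ≡ suc d → All (_⊆ U) 𝒜 → All (λ A → ∣ A ∣ ≤ d) 𝒜 →
             AllPairs Incomparable 𝒜 → sum (map (lymWeight (suc d)) 𝒜) ≤ suc d !
  lym-step {d} ih {U} {𝒜} ∣U∣≡1+d ⊆U small inc = begin
    sum (map (lymWeight (suc d)) 𝒜)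
      ≡⟨ cong sum (map-cong-local (All.map weight-step (All.zip (⊆U , small)))) ⟩
    sum (map (λ A → lymWeight d A * length (filter (λ i → i ∈? U ─ A) (allFin n))) 𝒜)
      ≡⟨ sum-map-filter-comm (λ i A → i ∈? U ─ A) (lymWeight d) (allFin n) 𝒜 ⟨
    sum (map (λ i → sum (map (lymWeight d) (filter (λ A → i ∈? U ─ A) 𝒜))) (allFin n))
      ≤⟨ sum-map-mono (All.universal link-bound (allFin n)) ⟩
    sum (map (λ i → if does (i ∈? U) then d ! else 0) (allFin n))
      ≡⟨ sum-map-if (_∈? U) (d !) (allFin n) ⟩
    d ! * length (filter (_∈? U) (allFin n))
      ≡⟨ cong (d ! *_) (trans (length-filter-∈?≡∣p∣ U) ∣U∣≡1+d) ⟩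
    d ! * suc d
      ≡⟨ *-comm (d !) (suc d) ⟩
    suc d ! ∎
    where
    open ≤-Reasoning
    weight-step : ∀ {A} → A ⊆ U × ∣ A ∣ ≤ d →
                  lymWeight (suc d) A ≡ lymWeight d A * length (filter (λ i → i ∈? U ─ A) (allFin n))
    weight-step {A} (A⊆U , ∣A∣≤d) = begin-equality
      lymWeight (suc d) A              ≡⟨ lymWeight-suc A ∣A∣≤d ⟩
      lymWeight d A * (suc d ∸ ∣ A ∣)  ≡⟨ cong (λ m → lymWeight d A * (m ∸ ∣ A ∣)) ∣U∣≡1+d ⟨
      lymWeight d A * (∣ U ∣ ∸ ∣ A ∣)  ≡⟨ cong (lymWeight d A *_) (∣p─q∣≡∣p∣∸∣q∣ U A A⊆U) ⟨
      lymWeight d A * ∣ U ─ A ∣        ≡⟨ cong (lymWeight d A *_) (length-filter-∈?≡∣p∣ (U ─ A)) ⟨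
      lymWeight d A * length (filter (λ i → i ∈? U ─ A) (allFin n)) ∎
    ⊆U-i : ∀ {A i} → A ⊆ U × i ∈ U ─ A → A ⊆ U - i
    ⊆U-i {A} (A⊆U , i∈U─A) = p⊆q∧x∉p⇒p⊆q-x A⊆U (x∈p─q⇒x∉q U A i∈U─A)
    link-bound : ∀ i → sum (map (lymWeight d) (filter (λ A → i ∈? U ─ A) 𝒜)) ≤ (if does (i ∈? U) then d ! else 0)
    link-bound i with i ∈? U
    ... | yes i∈U = ih (suc-injective (trans (+-comm 1 _) (trans (∣p-x∣+1≡∣p∣ i∈U) ∣U∣≡1+d)))
                       (All.zipWith (λ {A} → ⊆U-i {A})
                                    (AllP.filter⁺ (λ A → i ∈? U ─ A) ⊆U , all-filter (λ A → i ∈? U ─ A) 𝒜))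
                       (AllPairs.filter⁺ (λ A → i ∈? U ─ A) inc)
    ... | no  i∉U = ≤-reflexive (cong (sum ∘ map (lymWeight d))
                      (filter-none (λ A → i ∈? U ─ A)
                                   (All.map (λ {A} (A⊆U : A ⊆ U) i∈U─A → i∉U (p─q⊆p U A i∈U─A)) ⊆U)))

  lym : ∀ d → LYM d
  lym d {𝒜 = 𝒜} ∣U∣≡d ⊆U inc with any? (λ A → ∣ A ∣ ≟ d) 𝒜
  ... | yes full = lym-full ∣U∣≡d full ⊆U inc
  lym zero    {𝒜 = []}    _     _           _   | no _     = z≤n
  lym zero    {𝒜 = A ∷ _} ∣U∣≡0 (A⊆U ∷ _)   _   | no ¬full =
    contradiction (here (n≤0⇒n≡0 (subst (∣ A ∣ ≤_) ∣U∣≡0 (p⊆q⇒∣p∣≤∣q∣ A⊆U)))) ¬full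
  lym (suc d) {U} {𝒜} ∣U∣≡1+d ⊆U inc | no ¬full =
    lym-step (lym d) ∣U∣≡1+d ⊆U (All.zipWith ∣A∣≤d (⊆U , ¬Any⇒All¬ 𝒜 ¬full)) inc
    where
    ∣A∣≤d : ∀ {A} → A ⊆ U × ∣ A ∣ ≢ suc d → ∣ A ∣ ≤ d
    ∣A∣≤d (A⊆U , ∣A∣≢1+d) = ≤-pred (≤∧≢⇒< (subst (_ ≤_) ∣U∣≡1+d (p⊆q⇒∣p∣≤∣q∣ A⊆U)) ∣A∣≢1+d)

  antichain-length≤ : ∀ {U 𝒜 T} → All (_⊆ U) 𝒜 → AllPairs Incomparable 𝒜 →
                      All (λ A → ∣ U ∣ C ∣ A ∣ ≤ T) 𝒜 → length 𝒜 ≤ T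
  antichain-length≤ {U} {𝒜} {T} ⊆U inc C≤T = *-cancelʳ-≤ (length 𝒜) T (d !) {{d !≢0}} (begin
    length 𝒜 * d !                 ≡⟨ sum-map-const (d !) 𝒜 ⟨
    sum (map (λ _ → d !) 𝒜)        ≤⟨ sum-map-mono (All.zipWith d!≤T*weight (⊆U , C≤T)) ⟩
    sum (map (λ A → T * lymWeight d A) 𝒜) ≡⟨ sum-map-*ˡ T (lymWeight d) 𝒜 ⟩
    T * sum (map (lymWeight d) 𝒜)  ≤⟨ *-monoʳ-≤ T (lym d refl ⊆U inc) ⟩
    T * d !                        ∎)
    where
    open ≤-Reasoning
    d = ∣ U ∣
    d!≤T*weight : ∀ {A} → A ⊆ U × d C ∣ A ∣ ≤ T → d ! ≤ T * lymWeight d A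
    d!≤T*weight {A} (A⊆U , C≤T) = begin
      d !                          ≡⟨ nCk*k![n∸k]!≡n! (p⊆q⇒∣p∣≤∣q∣ A⊆U) ⟨
      (d C ∣ A ∣) * lymWeight d A  ≤⟨ *-monoˡ-≤ (lymWeight d A) C≤T ⟩
      T * lymWeight d A            ∎

∈⇒≤foldr⊔ : ∀ {m ms} → m List.∈ ms → m ≤ foldr _⊔_ 0 ms
∈⇒≤foldr⊔ (here refl) = m≤m⊔n _ _
∈⇒≤foldr⊔ {ms = m′ ∷ _} (there m∈ms) = ≤-trans (∈⇒≤foldr⊔ m∈ms) (m≤n⊔m m′ _)

degree≤maxDegree : ∀ {n} (H : Graph n) x → degree H x ≤ maxDegree H
degree≤maxDegree H x = ∈⇒≤foldr⊔ (∈-map⁺ (degree H) (∈-allFin x))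

clique-x⊆nbhd : ∀ {n} (H : Graph n) {K : Subset n} {x} → IsClique H K → x ∈ K → K - x ⊆ nbhd H x
clique-x⊆nbhd H {K} {x} K-clique x∈K {y} y∈K-x =
  lookup⇒[]= y (Data.Vec.tabulate (adj H x)) (trans (lookup∘tabulate (adj H x) y) adj-x-y)
  where
  adj-x-y : adj H x y ≡ true
  adj-x-y = K-clique x y x∈K (p─q⊆p K ⁅ x ⁆ y∈K-x) (x∉⁅y⁆⇒x≢y (x∈p─q⇒x∉q K ⁅ x ⁆ y∈K-x) ∘ sym)

allPairs-mapWithAll : ∀ {P : A → Set} {R S : A → A → Set} → (∀ {a b} → P a → P b → R a b → S a b) →
                      ∀ {xs} → All P xs → AllPairs R xs → AllPairs S xs
allPairs-mapWithAll f []         []           = []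
allPairs-mapWithAll f (pa ∷ pxs) (Ra ∷ Rxs) = All.zipWith (λ (pb , Rab) → f pa pb Rab) (pxs , Ra) ∷ allPairs-mapWithAll f pxs Rxs

[k∸1]+[k∸1]≤1+[2k∸3] : ∀ {k} → 2 ≤ k → (k ∸ 1) + (k ∸ 1) ≤ suc (2 * k ∸ 3)
[k∸1]+[k∸1]≤1+[2k∸3] {suc (suc j)} (s≤s (s≤s z≤n)) = ≤-reflexive (cong suc (begin
  j + suc j                   ≡⟨ cong (λ m → j + suc m) (+-identityʳ j) ⟨
  j + suc (j + 0)             ≡⟨ cong (_∸ 1) (+-suc j (suc (j + 0))) ⟨
  j + suc (suc (j + 0)) ∸ 1   ∎))
  where open ≡-Reasoning

corollary19 : ∀ {n} (H : Graph n) (k : ℕ) → 2 ≤ k →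
    ∀ {m} (F : Fin m → Subset n) →
    (∀ i → ∣ F i ∣ ≤ k) →
    (∀ i j → i ≢ j → ¬ (F i ⊆ F j)) →
    (∀ i → IsClique H (F i)) →
    ∀ (x : Fin n) →
      countContaining F x ≤ (maxDegree H C (k ∸ 1)) ⊔ ((2 * k ∸ 3) C (k ∸ 1))
corollary19 H k 2≤k {m} F ∣F∣≤k F-antichain F-cliques x = begin
  countContaining F x  ≡⟨ length-map (λ i → F i - x) members ⟨
  length 𝒜             ≤⟨ antichain-length≤ 𝒜⊆nbhd 𝒜-antichain 𝒜-binomial≤ ⟩
  (maxDegree H C (k ∸ 1)) ⊔ ((2 * k ∸ 3) C (k ∸ 1)) ∎
  where
  open ≤-Reasoning
  members = filter (λ i → x ∈? F i) (allFin m)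
  𝒜 = map (λ i → F i - x) members
  x∈members : All (λ i → x ∈ F i) members
  x∈members = all-filter (λ i → x ∈? F i) (allFin m)
  𝒜⊆nbhd : All (_⊆ nbhd H x) 𝒜
  𝒜⊆nbhd = AllP.map⁺ (All.map (clique-x⊆nbhd H (F-cliques _)) x∈members)
  𝒜-antichain : AllPairs Incomparable 𝒜
  𝒜-antichain = AllPairs.map⁺ (allPairs-mapWithAll
    (λ {i} {j} x∈Fi x∈Fj i≢j → F-antichain i j i≢j ∘ p-x⊆q-x⇒p⊆q x∈Fj
                             , F-antichain j i (i≢j ∘ sym) ∘ p-x⊆q-x⇒p⊆q x∈Fi)
    x∈members (AllPairs.filter⁺ (λ i → x ∈? F i) (allFin⁺ m)))
  ∣F-x∣≤k∸1 : ∀ {i} → x ∈ F i → ∣ F i - x ∣ ≤ k ∸ 1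
  ∣F-x∣≤k∸1 {i} x∈Fi = m+n≤o⇒m≤o∸n ∣ F i - x ∣ (subst (_≤ k) (sym (∣p-x∣+1≡∣p∣ x∈Fi)) (∣F∣≤k i))
  𝒜-binomial≤ : All (λ A → degree H x C ∣ A ∣ ≤ (maxDegree H C (k ∸ 1)) ⊔ ((2 * k ∸ 3) C (k ∸ 1))) 𝒜
  𝒜-binomial≤ = AllP.map⁺ (All.map (λ x∈Fi →
    binomial≤max (degree≤maxDegree H x) (∣F-x∣≤k∸1 x∈Fi) ([k∸1]+[k∸1]≤1+[2k∸3] 2≤k)) x∈members)
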